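{- Let $G=(V,E)$ be a finite connected simple graph and let $P$ be an induced path in $G$ that is not a shortest path between its endpoints. Then there exists a metric $d$ on $V$ whose betweenness relation $\beta_d=\{(x,y,z)\in V^3: d(x,z)=d(x,y)+d(y,z)\}$ satisfies: the adjacency graph of $(V,\beta_d)$ is $G$, $\beta_d\not\supseteq\beta_G$ and $\beta_d\not\subseteq\beta_G$, where $\beta_G$ is the betweenness relation of the shortest-path metric of $G$.
   Context: The adjacency graph of a betweenness structure $(X,\beta)$ is the simple graph on $X$ whose edges are the pairs $\{x,z\}$ of distinct points such that there is no $y\in X\setminus\{x,z\}$ with $(x,y,z)\in\beta$. In the paper's notation, with $\mathcal{B}=(V,\beta_d)$ and $\mathcal{B}(G)=(V,\beta_G)$, the conclusion reads $\mathcal{B}\not\preccurlyeq\mathcal{B}(G)$ and $\mathcal{B}\not\succcurlyeq\mathcal{B}(G)$, where $(X,\alpha)\preccurlyeq(X,\beta)$ means $\alpha\supseteq\beta$. -}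

module Defs where

open import Data.Nat using (ℕ; zero; suc; _+_; _≤_; _<_)
open import Data.Fin using (Fin; toℕ)
open import Data.Bool using (Bool; true; false)
open import Data.Product using (Σ; ∃; _×_; _,_)
open import Relation.Binary.PropositionalEquality using (_≡_; _≢_)
open import Relation.Nullary using (¬_)
open import Function using (_⇔_)
open import Data.Sum using (_⊎_)

record SimpleGraph (n : ℕ) : Set where
  field
    adj      : Fin n → Fin n → Bool
    adj-sym  : ∀ x y → adj x y ≡ adj y x
    adj-irr  : ∀ x → adj x x ≡ false

open SimpleGraph public

Adj : ∀ {n} → SimpleGraph n → Fin n → Fin n → Set
Adj G x y = adj G x y ≡ true

data Walk {n : ℕ} (G : SimpleGraph n) : Fin n → Fin n → ℕ → Set where
  nil  : ∀ {x} → Walk G x x 0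
  cons : ∀ {x y z k} → Adj G x y → Walk G y z k → Walk G x z (suc k)

Connected : ∀ {n} → SimpleGraph n → Set
Connected G = ∀ x y → ∃ λ k → Walk G x y k

IsDist : ∀ {n} → SimpleGraph n → Fin n → Fin n → ℕ → Set
IsDist G x y k = Walk G x y k × (∀ m → Walk G x y m → k ≤ m)

βG : ∀ {n} → SimpleGraph n → Fin n → Fin n → Fin n → Set
βG G x y z = Σ ℕ λ a → Σ ℕ λ b → Σ ℕ λ c →
  IsDist G x y a × IsDist G y z b × IsDist G x z c × c ≡ a + b

IsInducedPath : ∀ {n k} → SimpleGraph n → (Fin (suc k) → Fin n) → Set
IsInducedPath G p =
  (∀ i j → p i ≡ p j → i ≡ j) ×
  (∀ i j → Adj G (p i) (p j) ⇔ (suc (toℕ i) ≡ toℕ j ⊎ suc (toℕ j) ≡ toℕ i))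

record IsMetric {n : ℕ} (d : Fin n → Fin n → ℕ) : Set where
  field
    zero⇔eq  : ∀ x y → d x y ≡ 0 ⇔ x ≡ y
    sym      : ∀ x y → d x y ≡ d y x
    triangle : ∀ x y z → d x z ≤ d x y + d y z

βd : ∀ {n} → (Fin n → Fin n → ℕ) → Fin n → Fin n → Fin n → Set
βd d x y z = d x z ≡ d x y + d y z

AdjB : ∀ {n} → (Fin n → Fin n → Fin n → Set) → Fin n → Fin n → Set
AdjB β x z = x ≢ z × (∀ y → y ≢ x → y ≢ z → ¬ β x y z)

-- Give every edge of G a cost: 1 if both endpoints lie on P
-- ("light" edges, which are exactly the edges of P), and H = k + 2 otherwise
-- ("heavy" edges).  The cheapest-walk distance d is the required metric.
--
-- Then, for any symmetric edge weighting
-- of a connected graph, the cheapest-walk distance is a metric, and every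
-- pair of non-adjacent vertices has a point β-between them (the second
-- vertex of a cheapest walk).  The zero weighting shows that graph
-- distances exist.
-- For the path weighting one shows: a walk of cost < H between distinct
-- vertices starts and ends on P; d (p i) (p j) = j - i; the adjacency graph
-- of β_d is G.  Finally, if β_d ⊆ β_G then P would be a geodesic (by
-- induction along P), and a geodesic from p 0 to p k that is shorter than P
-- must leave P at some y, which is β_G- but not β_d-between p 0 and p k
-- because d (p 0) y ≥ H > k = d (p 0) (p k).
module Submission where

open import Defs
open import Data.Nat using (ℕ; zero; suc; _+_; _∸_; _≤_; _<_; z≤n; s≤s; _≤?_; s≤s⁻¹)
open import Data.Nat.Properties hiding (_≟_)
open import Data.Fin using (Fin; zero; suc; fromℕ; toℕ; fromℕ<; _≟_)
open import Data.Fin.Properties using (toℕ-injective; toℕ-fromℕ; toℕ-fromℕ<; toℕ<n; any?)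
open import Data.Bool using (true; false)
open import Data.Product using (Σ; ∃; _×_; _,_; proj₁; proj₂; swap)
open import Data.Sum using (_⊎_; inj₁; inj₂)
open import Data.Empty using (⊥-elim)
open import Relation.Nullary using (¬_; Dec; yes; no; contradiction)
open import Relation.Nullary.Decidable using (_×-dec_; map′)
open import Relation.Binary.PropositionalEquality hiding ([_])
open import Function using (_⇔_; mk⇔; Equivalence)

private variable
  n a b c m v : ℕ
  G : SimpleGraph n
  u x y z : Fin n

Least : (ℕ → Set) → ℕ → Set
Least P m = P m × (∀ j → P j → m ≤ j)

least : ∀ {P : ℕ → Set} → (∀ j → Dec (P j)) → ∀ b → P b → ∃ (Least P)
least P? b pb with P? 0
... | yes p0 = 0 , p0 , λ _ _ → z≤n
least P? zero    pb | no ¬p0 = ⊥-elim (¬p0 pb)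
least {P} P? (suc b) pb | no ¬p0 with least {λ j → P (suc j)} (λ j → P? (suc j)) b pb
... | m , pm , minimal = suc m , pm , λ { zero p → ⊥-elim (¬p0 p) ; (suc j) p → s≤s (minimal j p) }

Adj-irrefl : (G : SimpleGraph n) → ¬ Adj G x x
Adj-irrefl {x = x} G e with trans (sym (adj-irr G x)) e
... | ()

Adj-sym : (G : SimpleGraph n) → Adj G x y → Adj G y x
Adj-sym {x = x} {y} G e = trans (adj-sym G y x) e

Adj? : (G : SimpleGraph n) → ∀ x y → Dec (Adj G x y)
Adj? G x y with adj G x y
... | true  = yes refl
... | false = no λ ()

_++ʷ_ : Walk G x y a → Walk G y z b → Walk G x z (a + b)
nil      ++ʷ W₂ = W₂
cons e W ++ʷ W₂ = cons e (W ++ʷ W₂)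

IsDist-unique : IsDist G x y a → IsDist G x y b → a ≡ b
IsDist-unique (Wa , minimal-a) (Wb , minimal-b) = ≤-antisym (minimal-a _ Wb) (minimal-b _ Wa)

IsDist-refl : IsDist G x x 0
IsDist-refl = nil , λ _ _ → z≤n

-- Adjacent vertices are at distance 1 (a walk of length 0 would be a loop).
IsDist-edge : Adj G x y → IsDist G x y 1
IsDist-edge {G = G} e = cons e nil , λ { zero nil → ⊥-elim (Adj-irrefl G e) ; (suc _) _ → s≤s z≤n }

-- Any vertex on a geodesic from x to z is β_G-between x and z: the two
-- pieces of the geodesic are geodesics themselves.
geodesic-between : IsDist G x z c → Walk G x y a → Walk G y z b → a + b ≡ c → βG G x y z
geodesic-between {c = c} {a = a} {b = b} D@(_ , minimal) W₁ W₂ a+b≡c =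
  a , b , c , (W₁ , first-geodesic) , (W₂ , second-geodesic) , D , sym a+b≡c
  where
  first-geodesic : ∀ j → Walk _ _ _ j → a ≤ j
  first-geodesic j W = +-cancelʳ-≤ b a j (subst (_≤ j + b) (sym a+b≡c) (minimal _ (W ++ʷ W₂)))
  second-geodesic : ∀ j → Walk _ _ _ j → b ≤ j
  second-geodesic j W = +-cancelˡ-≤ a b j (subst (_≤ a + j) (sym a+b≡c) (minimal _ (W₁ ++ʷ W)))

-- Cheapest-walk distance of a symmetric edge weighting; an edge x y costs
-- 1 + w x y, so walks of cost 0 are trivial.
module WeightedDistance {n : ℕ} (G : SimpleGraph n) (conn : Connected G)
  (w : Fin n → Fin n → ℕ) (w-sym : ∀ x y → w x y ≡ w y x) where

  weight : Walk G x y m → ℕ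
  weight nil                        = 0
  weight (cons {x = x} {y = y} _ W) = suc (w x y + weight W)

  length≤weight : (W : Walk G x y m) → m ≤ weight W
  length≤weight nil        = z≤n
  length≤weight (cons _ W) = s≤s (≤-trans (length≤weight W) (m≤n+m _ _))

  weight-++ : (W₁ : Walk G x y a) (W₂ : Walk G y z b) →
              weight (W₁ ++ʷ W₂) ≡ weight W₁ + weight W₂
  weight-++ nil                        W₂ = refl
  weight-++ (cons {x = x} {y = y} _ W) W₂ =
    cong suc (trans (cong (w x y +_) (weight-++ W W₂)) (sym (+-assoc (w x y) _ _)))

  Reach : Fin n → Fin n → ℕ → Set
  Reach x y v = Σ ℕ λ m → Σ (Walk G x y m) λ W → weight W ≡ v

  reach-walk : (W : Walk G x y m) → Reach x y (weight W)
  reach-walk W = _ , W , refl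

  reach-++ : Reach x y a → Reach y z b → Reach x z (a + b)
  reach-++ (_ , W₁ , refl) (_ , W₂ , refl) = _ , W₁ ++ʷ W₂ , weight-++ W₁ W₂

  reach-edge : Adj G x y → Reach x y (suc (w x y))
  reach-edge e = 1 , cons e nil , cong suc (+-identityʳ _)

  reach-zero : Reach x y 0 → x ≡ y
  reach-zero (_ , nil , _) = refl

  reverse : (W : Walk G x y m) → Reach y x (weight W)
  reverse nil                        = reach-walk nil
  reverse (cons {x = x} {y = y} e W) =
    subst (Reach _ x) reversed-cost (reach-++ (reverse W) (reach-edge (Adj-sym G e)))
    where
    open ≡-Reasoning
    reversed-cost : weight W + suc (w y x) ≡ suc (w x y + weight W)
    reversed-cost = begin
      weight W + suc (w y x)   ≡⟨ +-suc (weight W) (w y x) ⟩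
      suc (weight W + w y x)   ≡⟨ cong suc (+-comm (weight W) (w y x)) ⟩
      suc (w y x + weight W)   ≡⟨ cong (λ q → suc (q + weight W)) (w-sym y x) ⟩
      suc (w x y + weight W)   ∎

  -- Reachability at a given cost is decidable, by recursion on the cost
  -- (with explicit fuel) through the first edge of the walk.
  reach? : ∀ fuel v → v ≤ fuel → ∀ x y → Dec (Reach x y v)
  reach? _ zero _ x y with x ≟ y
  ... | yes refl = yes (reach-walk nil)
  ... | no x≢y   = no λ r → x≢y (reach-zero r)
  reach? (suc fuel) (suc v) (s≤s v≤fuel) x y =
    map′ join split
      (any? λ z → Adj? G x z ×-dec ((w x z ≤? v) ×-dec
                    reach? fuel (v ∸ w x z) (≤-trans (m∸n≤m v (w x z)) v≤fuel) z y))
    where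
    FirstStep : Fin n → Set
    FirstStep z = Adj G x z × w x z ≤ v × Reach z y (v ∸ w x z)
    join : ∃ FirstStep → Reach x y (suc v)
    join (z , e , w≤v , m , W , cost) =
      suc m , cons e W , cong suc (trans (cong (w x z +_) cost) (m+[n∸m]≡n w≤v))
    split : Reach x y (suc v) → ∃ FirstStep
    split (_ , cons {y = z} e W , cost) =
      z , e , subst (w x z ≤_) rest (m≤m+n _ _) ,
      _ , W , sym (trans (cong (_∸ w x z) (sym rest)) (m+n∸m≡n (w x z) (weight W)))
      where
      rest : w x z + weight W ≡ v
      rest = suc-injective cost

  cheapest : ∀ x y → ∃ (Least (Reach x y))
  cheapest x y = least (λ v → reach? v v ≤-refl x y) _ (reach-walk (proj₂ (conn x y)))

  d : Fin n → Fin n → ℕ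
  d x y = proj₁ (cheapest x y)

  d-reach : ∀ x y → Reach x y (d x y)
  d-reach x y = proj₁ (proj₂ (cheapest x y))

  d-≤ : Reach x y v → d x y ≤ v
  d-≤ {v = v} r = proj₂ (proj₂ (cheapest _ _)) v r

  d-metric : IsMetric d
  d-metric = record
    { zero⇔eq  = λ x y → mk⇔ (λ d≡0 → reach-zero (subst (Reach x y) d≡0 (d-reach x y)))
                              (λ { refl → n≤0⇒n≡0 (d-≤ (reach-walk {x = x} nil)) })
    ; sym      = λ x y → ≤-antisym (d-≤ (reverse-reach (d-reach y x)))
                                   (d-≤ (reverse-reach (d-reach x y)))
    ; triangle = λ x y z → d-≤ (reach-++ (d-reach x y) (d-reach y z))
    }
    where
    reverse-reach : Reach x y v → Reach y x v
    reverse-reach (_ , W , refl) = reverse W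

  d-pos : x ≢ y → 0 < d x y
  d-pos {x} {y} x≢y = n≢0⇒n>0 λ d≡0 → x≢y (Equivalence.to (IsMetric.zero⇔eq d-metric x y) d≡0)

  d-edge : Adj G x y → d x y ≤ suc (w x y)
  d-edge e = d-≤ (reach-edge e)

  -- If no point is β_d-between x ≠ z, then x and z are adjacent: otherwise
  -- the second vertex of a cheapest walk from x to z would be between them.
  adjB⇒adj : AdjB (βd d) x z → Adj G x z
  adjB⇒adj {x} {z} (x≢z , nothing-between) with d-reach x z
  ... | _ , nil , _ = ⊥-elim (x≢z refl)
  ... | _ , cons {y = y} e W , cost with y ≟ z
  ...   | yes refl = e
  ...   | no y≢z   = ⊥-elim (nothing-between y y≢x y≢z between)
    where
    y≢x : y ≢ x
    y≢x refl = Adj-irrefl G e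
    between : d x z ≡ d x y + d y z
    between = ≤-antisym (IsMetric.triangle d-metric x y z) (begin
      d x y + d y z            ≤⟨ +-mono-≤ (d-edge e) (d-≤ (reach-walk W)) ⟩
      suc (w x y + weight W)   ≡⟨ cost ⟩
      d x z                    ∎)
      where open ≤-Reasoning

  record PassesThrough {x z : Fin n} {c : ℕ} (W : Walk G x z c) (y : Fin n) : Set where
    constructor passes
    field
      {prefix-length suffix-length} : ℕ
      prefix  : Walk G x y prefix-length
      suffix  : Walk G y z suffix-length
      lengths : prefix-length + suffix-length ≡ c
      weights : weight prefix + weight suffix ≡ weight W

  passes-head : (e : Adj G x y) (W : Walk G y z c) → PassesThrough (cons e W) y
  passes-head {x = x} {y = y} e W =
    passes (cons e nil) W refl (cong (λ q → suc (q + weight W)) (+-identityʳ (w x y)))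

  passes-cons : (e : Adj G x y) {W : Walk G y z c} → PassesThrough W u → PassesThrough (cons e W) u
  passes-cons {x = x} {y = y} e (passes W₁ W₂ lengths weights) =
    passes (cons e W₁) W₂ (cong suc lengths)
      (cong suc (trans (+-assoc (w x y) _ _) (cong (w x y +_) weights)))

-- Graph distances exist: they are the cheapest-walk distance of the zero
-- weighting, under which the cost of a walk is its length.
shortest-path : Connected G → ∀ x y → ∃ (IsDist G x y)
shortest-path {G = G} conn x y = len , walk , minimal
  where
  open WeightedDistance G conn (λ _ _ → 0) (λ _ _ → refl)
  weight≡length : (W : Walk G u z m) → weight W ≡ m
  weight≡length nil        = refl
  weight≡length (cons _ W) = cong suc (weight≡length W)
  len : ℕ
  len = proj₁ (d-reach x y)
  walk : Walk G x y len
  walk = proj₁ (proj₂ (d-reach x y))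
  minimal : ∀ j → Walk G x y j → len ≤ j
  minimal j W′ = begin
    len         ≡⟨ sym (weight≡length walk) ⟩
    weight walk ≡⟨ proj₂ (proj₂ (d-reach x y)) ⟩
    d x y       ≤⟨ d-≤ (reach-walk W′) ⟩
    weight W′   ≡⟨ weight≡length W′ ⟩
    j           ∎
    where open ≤-Reasoning

module PathWeighting {n k : ℕ} (G : SimpleGraph n) (conn : Connected G)
  (p : Fin (suc k) → Fin n) (induced : IsInducedPath G p) where

  OnP : Fin n → Set
  OnP x = ∃ λ i → p i ≡ x

  on-path : ∀ i → OnP (p i)
  on-path i = i , refl

  onP? : ∀ x → Dec (OnP x)
  onP? x = any? λ i → p i ≟ x

  Light : Fin n → Fin n → Set
  Light x y = OnP x × OnP y

  w : Fin n → Fin n → ℕ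
  w x y with onP? x ×-dec onP? y
  ... | yes _ = 0
  ... | no _  = suc k

  -- The cost 1 + w x y of a heavy edge.
  H : ℕ
  H = suc (suc k)

  w-light : Light x y → w x y ≡ 0
  w-light {x} {y} light with onP? x ×-dec onP? y
  ... | yes _     = refl
  ... | no ¬light = ⊥-elim (¬light light)

  w-cases : ∀ x y → Light x y ⊎ w x y ≡ suc k
  w-cases x y with onP? x ×-dec onP? y
  ... | yes light = inj₁ light
  ... | no _      = inj₂ refl

  w-bound : ∀ x y → w x y ≤ suc k
  w-bound x y with w-cases x y
  ... | inj₁ light = ≤-trans (≤-reflexive (w-light light)) z≤n
  ... | inj₂ heavy = ≤-reflexive heavy

  w-sym : ∀ x y → w x y ≡ w y x
  w-sym x y with w-cases x y | w-cases y x
  ... | inj₁ light | _          = trans (w-light light) (sym (w-light (swap light)))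
  ... | inj₂ _     | inj₁ light = trans (w-light (swap light)) (sym (w-light light))
  ... | inj₂ heavy | inj₂ heavy′ = trans heavy (sym heavy′)

  open WeightedDistance G conn w w-sym public

  -- A walk of cost below H uses only light edges, so it starts and ends on P
  -- unless it is trivial.
  light-walk : (W : Walk G x y m) → weight W < H → x ≢ y → Light x y
  light-walk nil _ x≢y = ⊥-elim (x≢y refl)
  light-walk {y = z} (cons {x = x} {y = y} e W) cost<H _ with w-cases x y
  ... | inj₂ heavy =
    ⊥-elim (<⇒≱ cost<H (s≤s (≤-trans (≤-reflexive (sym heavy)) (m≤m+n (w x y) (weight W)))))
  ... | inj₁ (x-on , y-on) with y ≟ z
  ...   | yes refl = x-on , y-on
  ...   | no y≢z   =
    x-on , proj₂ (light-walk W (≤-trans (s≤s (m≤n+m _ (w x y))) (≤-trans (n≤1+n _) cost<H)) y≢z)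

  heavy-walk : (W : Walk G x y m) → OnP x → ¬ OnP y → H ≤ weight W
  heavy-walk W x-on y-off = ≮⇒≥ λ cost<H → y-off (proj₂ (light-walk W cost<H λ { refl → y-off x-on }))

  d-heavy : OnP x → ¬ OnP y → H ≤ d x y
  d-heavy {x} {y} x-on y-off with d-reach x y
  ... | _ , W , cost = subst (H ≤_) cost (heavy-walk W x-on y-off)

  d-light : d x y < H → x ≢ y → Light x y
  d-light {x} {y} d<H x≢y with d-reach x y
  ... | _ , W , cost = light-walk W (subst (_< H) (sym cost) d<H) x≢y

  p-injective : ∀ i j → p i ≡ p j → i ≡ j
  p-injective = proj₁ induced

  index-step : ∀ i j → Adj G (p i) (p j) → toℕ j ≤ suc (toℕ i)
  index-step i j e with Equivalence.to (proj₂ induced i j) e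
  ... | inj₁ forward  = ≤-reflexive (sym forward)
  ... | inj₂ backward = ≤-trans (n≤1+n (toℕ j)) (≤-trans (≤-reflexive backward) (n≤1+n (toℕ i)))

  next : (i : Fin (suc k)) → toℕ i < k → Fin (suc k)
  next i i<k = fromℕ< (s≤s i<k)

  toℕ-next : ∀ i (i<k : toℕ i < k) → toℕ (next i i<k) ≡ suc (toℕ i)
  toℕ-next i i<k = toℕ-fromℕ< (s≤s i<k)

  adj-next : ∀ i (i<k : toℕ i < k) → Adj G (p i) (p (next i i<k))
  adj-next i i<k = Equivalence.from (proj₂ induced i (next i i<k)) (inj₁ (sym (toℕ-next i i<k)))

  before-last : ∀ (i j : Fin (suc k)) t → toℕ i + suc t ≡ toℕ j → toℕ i < k
  before-last i j t i+t≡j = begin-strict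
    toℕ i          <⟨ m<m+n (toℕ i) (s≤s z≤n) ⟩
    toℕ i + suc t  ≡⟨ i+t≡j ⟩
    toℕ j          ≤⟨ s≤s⁻¹ (toℕ<n j) ⟩
    k              ∎
    where open ≤-Reasoning

  offset-next : ∀ (i j : Fin (suc k)) t (i<k : toℕ i < k) →
                toℕ i + suc t ≡ toℕ j → toℕ (next i i<k) + t ≡ toℕ j
  offset-next i j t i<k i+t≡j =
    trans (cong (_+ t) (toℕ-next i i<k)) (trans (sym (+-suc (toℕ i) t)) i+t≡j)

  offset-zero : ∀ (i j : Fin (suc k)) → toℕ i + 0 ≡ toℕ j → i ≡ j
  offset-zero i j i+0≡j = toℕ-injective (trans (sym (+-identityʳ (toℕ i))) i+0≡j)

  offset≤k : ∀ (i j : Fin (suc k)) t → toℕ i + t ≡ toℕ j → t ≤ k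
  offset≤k i j t i+t≡j = ≤-trans (m≤n+m t (toℕ i)) (≤-trans (≤-reflexive i+t≡j) (s≤s⁻¹ (toℕ<n j)))

  along-path : ∀ t i j → toℕ i + t ≡ toℕ j → Σ (Walk G (p i) (p j) t) λ W → weight W ≡ t
  along-path zero i j i+0≡j with offset-zero i j i+0≡j
  ... | refl = nil , refl
  along-path (suc t) i j i+t≡j =
    cons (adj-next i i<k) (proj₁ rest) ,
    cong suc (trans (cong (_+ weight (proj₁ rest)) (w-light (on-path i , on-path i′))) (proj₂ rest))
    where
    i<k : toℕ i < k
    i<k = before-last i j t i+t≡j
    i′ : Fin (suc k)
    i′ = next i i<k
    rest : Σ (Walk G (p i′) (p j) t) λ W → weight W ≡ t
    rest = along-path t i′ j (offset-next i j t i<k i+t≡j)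

  leave-or-long : (W : Walk G x y c) → ∀ i j → p i ≡ x → p j ≡ y →
                  toℕ j ≤ toℕ i + c ⊎ ∃ λ u → ¬ OnP u × PassesThrough W u
  leave-or-long nil i j refl pj≡pi =
    inj₁ (≤-reflexive (trans (cong toℕ (p-injective j i pj≡pi)) (sym (+-identityʳ (toℕ i)))))
  leave-or-long (cons {y = u} e W) i j refl pj≡y with onP? u
  ... | no u-off = inj₂ (u , u-off , passes-head e W)
  ... | yes (i′ , refl) with leave-or-long W i′ j refl pj≡y
  ...   | inj₂ (v , v-off , through) = inj₂ (v , v-off , passes-cons e through)
  ...   | inj₁ j≤i′+c = inj₁ (≤-trans j≤i′+c (≤-trans (+-monoˡ-≤ _ (index-step i i′ e))
                                                    (≤-reflexive (sym (+-suc (toℕ i) _)))))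

  d-path : ∀ t i j → toℕ i + t ≡ toℕ j → d (p i) (p j) ≡ t
  d-path t i j i+t≡j = ≤-antisym (d-≤ (_ , along-path t i j i+t≡j)) lower
    where
    lower : t ≤ d (p i) (p j)
    lower with d-reach (p i) (p j)
    ... | len , W , cost with leave-or-long W i j refl refl
    ...   | inj₁ j≤i+len = begin
      t                     ≤⟨ +-cancelˡ-≤ (toℕ i) t len (subst (_≤ toℕ i + len) (sym i+t≡j) j≤i+len) ⟩
      len                   ≤⟨ length≤weight W ⟩
      weight W              ≡⟨ cost ⟩
      d (p i) (p j)         ∎
      where open ≤-Reasoning
    ...   | inj₂ (u , u-off , passes prefix suffix _ weights) = begin
      t                     ≤⟨ offset≤k i j t i+t≡j ⟩
      k                     ≤⟨ ≤-trans (n≤1+n k) (n≤1+n (suc k)) ⟩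
      H                     ≤⟨ heavy-walk prefix (on-path i) u-off ⟩
      weight prefix         ≤⟨ m≤m+n _ (weight suffix) ⟩
      weight prefix + weight suffix ≡⟨ weights ⟩
      weight W              ≡⟨ cost ⟩
      d (p i) (p j)         ∎
      where open ≤-Reasoning

  -- For an edge x z, d x z ≤ H, so a point
  -- strictly between x and z would be at distance < H from both; hence x, z
  -- lie on P, the edge is light, d x z = 1, and nothing fits in between.
  adjacency : ∀ x z → Adj G x z ⇔ AdjB (βd d) x z
  adjacency x z = mk⇔ adj⇒adjB adjB⇒adj
    where
    adj⇒adjB : Adj G x z → AdjB (βd d) x z
    adj⇒adjB e = (λ { refl → Adj-irrefl G e }) , nothing-between
      where
      nothing-between : ∀ y → y ≢ x → y ≢ z → ¬ βd d x y z
      nothing-between y y≢x y≢z between = contradiction two≤one λ { (s≤s ()) }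
        where
        x≢y : x ≢ y
        x≢y x≡y = y≢x (sym x≡y)
        sum≤H : d x y + d y z ≤ H
        sum≤H = ≤-trans (≤-reflexive (sym between)) (≤-trans (d-edge e) (s≤s (w-bound x z)))
        light : Light x z
        light = proj₁ (d-light (<-≤-trans (m<m+n (d x y) (d-pos y≢z)) sum≤H) x≢y) ,
                proj₂ (d-light (<-≤-trans (m<n+m (d y z) (d-pos x≢y)) sum≤H) y≢z)
        two≤one : 2 ≤ 1
        two≤one = begin
          2              ≤⟨ +-mono-≤ (d-pos x≢y) (d-pos y≢z) ⟩
          d x y + d y z  ≡⟨ sym between ⟩
          d x z          ≤⟨ d-edge e ⟩
          suc (w x z)    ≡⟨ cong suc (w-light light) ⟩
          1              ∎
          where open ≤-Reasoning

  K : Fin (suc k)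
  K = fromℕ k

  -- If β_d ⊆ β_G, every tail of P is a geodesic: p (i+1) is β_d-, hence
  -- β_G-between p i and p k, so G-distances add up along P.
  tail-geodesic : (∀ x y z → βd d x y z → βG G x y z) →
                  ∀ t i → toℕ i + t ≡ toℕ K → IsDist G (p i) (p K) t
  tail-geodesic _ zero i i+0≡K with offset-zero i K i+0≡K
  ... | refl = IsDist-refl
  tail-geodesic βd⊆βG (suc t) i i+t≡K = split (βd⊆βG _ _ _ between)
    where
    i<k : toℕ i < k
    i<k = before-last i K t i+t≡K
    i′ : Fin (suc k)
    i′ = next i i<k
    i′+t≡K : toℕ i′ + t ≡ toℕ K
    i′+t≡K = offset-next i K t i<k i+t≡K
    between : βd d (p i) (p i′) (p K)
    between = trans (d-path (suc t) i K i+t≡K)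
      (cong₂ _+_ (sym (d-path 1 i i′ (trans (+-comm (toℕ i) 1) (sym (toℕ-next i i<k)))))
                 (sym (d-path t i′ K i′+t≡K)))
    split : βG G (p i) (p i′) (p K) → IsDist G (p i) (p K) (suc t)
    split (a , b , c , Da , Db , Dc , c≡a+b) =
      subst (IsDist G (p i) (p K))
        (trans c≡a+b (cong₂ _+_ (IsDist-unique Da (IsDist-edge (adj-next i i<k)))
                                (IsDist-unique Db (tail-geodesic βd⊆βG t i′ i′+t≡K))))
        Dc

  -- If P is not a geodesic, a geodesic from p 0 to p k is shorter than P,
  -- so it leaves P at some u; u is β_G-between p 0 and p k, but not
  -- β_d-between them as d (p 0) u ≥ H > k = d (p 0) (p k).
  detour : ¬ IsDist G (p zero) (p K) k → ¬ (∀ x y z → βG G x y z → βd d x y z)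
  detour not-geodesic βG⊆βd with shortest-path conn (p zero) (p K)
  ... | c , geodesic@(W , minimal) with leave-or-long W zero K refl refl
  ...   | inj₁ K≤c = not-geodesic (subst (IsDist G (p zero) (p K)) c≡k geodesic)
    where
    c≡k : c ≡ k
    c≡k = ≤-antisym (minimal k (proj₁ (along-path k zero K (sym (toℕ-fromℕ k)))))
                    (subst (_≤ c) (toℕ-fromℕ k) K≤c)
  ...   | inj₂ (u , u-off , passes prefix suffix lengths _) =
    ⊥-elim (1+n≰n (≤-trans (n≤1+n (suc k)) H≤k))
    where
    open ≤-Reasoning
    H≤k : H ≤ k
    H≤k = begin
      H                                 ≤⟨ d-heavy (on-path zero) u-off ⟩
      d (p zero) u                      ≤⟨ m≤m+n _ _ ⟩
      d (p zero) u + d u (p K)          ≡⟨ sym (βG⊆βd _ _ _ (geodesic-between geodesic prefix suffix lengths)) ⟩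
      d (p zero) (p K)                  ≡⟨ d-path k zero K (sym (toℕ-fromℕ k)) ⟩
      k                                 ∎

lemma1 : ∀ {n k} (G : SimpleGraph n) → Connected G →
    (p : Fin (suc k) → Fin n) → IsInducedPath G p →
    ¬ IsDist G (p zero) (p (fromℕ k)) k →
    ∃ λ (d : Fin n → Fin n → ℕ) → IsMetric d ×
      (∀ x z → Adj G x z ⇔ AdjB (βd d) x z) ×
      ¬ (∀ x y z → βG G x y z → βd d x y z) ×
      ¬ (∀ x y z → βd d x y z → βG G x y z)
lemma1 {k = k} G conn p induced not-geodesic =
  d , d-metric , adjacency , detour not-geodesic ,
  λ βd⊆βG → not-geodesic (tail-geodesic βd⊆βG k zero (sym (toℕ-fromℕ k)))
  where open PathWeighting G conn p induced
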